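{- For every row-strict semi-standard Young tableau $T$, $st(\rho(T))=\rho(std(T))$.
   Context: Diagrams use the French convention: the diagram of $(\alpha_1,\dots,\alpha_\ell)$ has $\alpha_i$ left-justified cells in row $i$ from the bottom; cell $(i,j)$ is row $i$ from the bottom, column $j$ from the left. A composition is a finite sequence of positive integers; $\operatorname{shape}(\alpha)$ is its parts sorted decreasingly. A row-strict semi-standard Young tableau of partition shape $\lambda$ is a filling of the diagram of $\lambda$ with positive integers strictly increasing left to right in rows and weakly increasing bottom to top in columns. An SSYRT of shape a composition $\alpha$ is a filling $T$ of the diagram of $\alpha$ with positive integers such that, with $T(i,j)=\infty$ for cells outside the diagram: (1) rows strictly increase left to right; (2) the leftmost column weakly decreases from top to bottom; (3) for $1\le i<j\le\ell(\alpha)$ and $1\le k<m$ ($m$ the largest part), if $T(j,k)<T(i,k+1)$ then $T(j,k+1)\le T(i,k+1)$. The map $\rho$ from row-strict semi-standard Young tableaux to SSYRT: place the entries of the first column of $T$ into the first column of $\rho(T)$ in weakly decreasing order from top to bottom; then for $k\ge2$, place the entries of column $k$ of $T$ into column $k$ of $\rho(T)$ one at a time from smallest to largest, each entry $e$ going to cell $(i,k)$ for the highest row $i$ such that $(i,k)$ is not yet filled and $(i,k-1)$ contains an entry strictly smaller than $e$. Standardization $std$ of a row-strict semi-standard Young tableau $T$: the reading order reads the columns from right to left, each column from bottom to top; if $T$ contains $k_1$ ones, $k_2$ twos, etc., replace the ones by $1,\dots,k_1$ in reading order, then the twos by $k_1+1,\dots,k_1+k_2$ in reading order, and so on. Standardization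 $st$ of an SSYRT $F$: the standard reading order reads the columns from right to left, each column from top to bottom except the leftmost column, which is read from bottom to top. If $(\beta_1,\beta_2,\dots)$ is the content of $F$ ($\beta_t$ = number of entries equal to $t$), replace the $j$-th occurrence (in standard reading order) of the entry $t$ by $\beta_1+\dots+\beta_{t-1}+j$. -}

module Defs where

open import Data.Nat using (ℕ; zero; suc; _≤_; _<_; _<ᵇ_; _≤ᵇ_; _≡ᵇ_; _∸_)
open import Data.Bool using (Bool; true; false; _∧_; _∨_; if_then_else_)
open import Data.List using (List; []; _∷_; _++_; [_]; length; reverse; foldl; filter; map; upTo; last)
open import Data.List.Relation.Unary.All using (All)
open import Data.List.Relation.Unary.Linked using (Linked)
open import Data.Product using (_×_; _,_)
open import Data.Unit using (⊤)
open import Data.Empty using (⊥)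
open import Data.Maybe using (Maybe; just; nothing)
open import Relation.Nullary.Decidable using (Dec)
open import Relation.Binary.PropositionalEquality using (_≡_)

-- A filling of a diagram (French convention): list of rows, from the bottom
-- row upward; each row lists its entries from left to right (left-justified).
-- Rows are 0-indexed here (row 0 = bottom row), columns 0-indexed (column 0 = leftmost).
Filling : Set
Filling = List (List ℕ)

-- column condition between a row r and the row r' directly above it:
-- r' is no longer than r and r(j) ≤ r'(j) for every column j of r'
data Below : List ℕ → List ℕ → Set where
  below-[] : ∀ {r} → Below r []
  below-∷  : ∀ {x y r r'} → x ≤ y → Below r r' → Below (x ∷ r) (y ∷ r')

record RowStrictSSYT (T : Filling) : Set where
  field
    rowsNonEmpty   : All (λ r → 0 < length r) T
    positive       : All (All (λ x → 0 < x)) T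
    rowsStrict     : All (Linked _<_) T
    -- partition shape + columns weakly increasing bottom to top
    columnsWeak    : Linked Below T

-- Generic standardization w.r.t. a reading order.
-- prec i' j' i j = true  iff cell (i',j') comes before or equals (i,j) in
-- the reading order.  The entry t at cell c is replaced by
--   #{cells with entry < t} + #{cells with entry t read no later than c},
-- i.e. the j-th occurrence of t becomes β₁+…+β_{t-1}+j.

cellsRow : ℕ → ℕ → List ℕ → List (ℕ × ℕ × ℕ)
cellsRow i j [] = []
cellsRow i j (x ∷ xs) = (i , j , x) ∷ cellsRow i (suc j) xs

cellsFrom : ℕ → Filling → List (ℕ × ℕ × ℕ)
cellsFrom i [] = []
cellsFrom i (r ∷ rs) = cellsRow i 0 r ++ cellsFrom (suc i) rs

cells : Filling → List (ℕ × ℕ × ℕ)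
cells = cellsFrom 0

relabelRow : (ℕ → ℕ → ℕ → ℕ) → ℕ → ℕ → List ℕ → List ℕ
relabelRow f i j [] = []
relabelRow f i j (x ∷ xs) = f i j x ∷ relabelRow f i (suc j) xs

relabelFrom : (ℕ → ℕ → ℕ → ℕ) → ℕ → Filling → Filling
relabelFrom f i [] = []
relabelFrom f i (r ∷ rs) = relabelRow f i 0 r ∷ relabelFrom f (suc i) rs

countB : {A : Set} → (A → Bool) → List A → ℕ
countB p [] = 0
countB p (x ∷ xs) = if p x then suc (countB p xs) else countB p xs

standardizeBy : (ℕ → ℕ → ℕ → ℕ → Bool) → Filling → Filling
standardizeBy prec F =
  relabelFrom (λ i j v → countB (λ { (i' , j' , v') →
                   (v' <ᵇ v) ∨ ((v' ≡ᵇ v) ∧ prec i' j' i j) }) (cells F)) 0 F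

-- reading order of std: columns right to left, each column bottom to top
precStd : ℕ → ℕ → ℕ → ℕ → Bool
precStd i' j' i j = (j <ᵇ j') ∨ ((j' ≡ᵇ j) ∧ (i' ≤ᵇ i))

-- standard reading order of st: columns right to left, each column top to
-- bottom, except the leftmost column which is read bottom to top
precSt : ℕ → ℕ → ℕ → ℕ → Bool
precSt i' j' i j = (j <ᵇ j') ∨ ((j' ≡ᵇ j) ∧ (if j ≡ᵇ 0 then i' ≤ᵇ i else i ≤ᵇ i'))

std : Filling → Filling
std = standardizeBy precStd

st : Filling → Filling
st = standardizeBy precSt

insertAsc : ℕ → List ℕ → List ℕ
insertAsc x [] = x ∷ []
insertAsc x (y ∷ ys) = if x ≤ᵇ y then x ∷ y ∷ ys else y ∷ insertAsc x ys

sortAsc : List ℕ → List ℕ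
sortAsc [] = []
sortAsc (x ∷ xs) = insertAsc x (sortAsc xs)

lookupM : List ℕ → ℕ → Maybe ℕ
lookupM [] _ = nothing
lookupM (x ∷ xs) zero = just x
lookupM (x ∷ xs) (suc k) = lookupM xs k

column : ℕ → Filling → List ℕ
column k [] = []
column k (r ∷ rs) with lookupM r k
... | just x  = x ∷ column k rs
... | nothing = column k rs

lastLt : List ℕ → ℕ → Bool
lastLt r e with last r
... | just x  = x <ᵇ e
... | nothing = false

-- on rows listed TOP to bottom: put e into column k (k ≥ 1) of the first
-- (i.e. highest) row whose column k is empty and whose column k-1 holds an
-- entry < e.  (Rows are filled contiguously, so "column k empty and column
-- k-1 filled" means "length = k".)
placeTopDown : ℕ → ℕ → Filling → Filling
placeTopDown k e [] = []
placeTopDown k e (r ∷ rs) =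
  if (length r ≡ᵇ k) ∧ lastLt r e then (r ++ [ e ]) ∷ rs
  else r ∷ placeTopDown k e rs

place : ℕ → ℕ → Filling → Filling
place k e rows = reverse (placeTopDown k e (reverse rows))

-- first column: weakly decreasing from top to bottom = ascending bottom to top
firstColumn : Filling → Filling
firstColumn T = map [_] (sortAsc (column 0 T))

numCols : Filling → ℕ
numCols [] = 0
numCols (r ∷ _) = length r

placeColumn : Filling → Filling → ℕ → Filling
placeColumn T rows k = foldl (λ rs e → place k e rs) rows (sortAsc (column k T))

ρ : Filling → Filling
ρ T = foldl (placeColumn T) (firstColumn T) (map suc (upTo (numCols T ∸ 1)))

-- Tag every entry of T with its cell.  ρ compares an entry only with entries of the column to its
-- left, by <, and inserts every column in increasing order.  The std labels increase up each column
-- and preserve all comparisons with entries further left (equal entries in different columns are read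
-- right column first), so ρ (std T) is ρ T with each entry replaced by the std label of its source
-- cell.  It remains to see that st gives every entry of ρ T that same label.  Entries keep their
-- columns, and none is lost: row strictness gives Hall's condition #{≤ e in column k + 1} ≤
-- #{< e in column k}, so every insertion finds a row.  Finally, equal entries of a column are
-- inserted bottom to top of T, each into the highest admissible row, and a row that refused one of
-- them refuses the later ones; so in column 0 they keep the order of their source rows and in the
-- other columns they reverse it -- exactly how st reads each column.
module Submission where

open import Defs
open import Data.Bool using (Bool; true; false; _∧_; _∨_; if_then_else_)
open import Data.Empty using (⊥; ⊥-elim)
open import Data.List using (List; []; _∷_; _++_; [_]; length; reverse; foldl; map; upTo; last; concat; applyUpTo; take; fromMaybe)
import Data.List.Properties as List
open import Data.List.Membership.Propositional using (_∈_)
open import Data.List.Membership.Propositional.Properties using (∈-++⁺ˡ; ∈-++⁺ʳ; ∈-++⁻)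
open import Data.List.Relation.Binary.Permutation.Propositional using (_↭_; ↭-refl; ↭-sym; ↭-trans; ↭-reflexive; ↭-prep; module PermutationReasoning)
import Algebra
import Data.List.Relation.Binary.Permutation.Propositional.Properties as ↭
open import Data.List.Relation.Unary.All as All using (All; []; _∷_)
import Data.List.Relation.Unary.All.Properties as Allₚ
open import Data.List.Relation.Unary.AllPairs as AllPairs using (AllPairs; []; _∷_)
import Data.List.Relation.Unary.AllPairs.Properties as AllPairsₚ
open import Data.List.Relation.Unary.Any using (Any; here; there)
open import Data.List.Relation.Unary.Linked as Linked using (Linked)
open import Data.Maybe as Maybe using (Maybe; just; nothing)
import Data.Maybe.Properties as Maybe
open import Data.Nat using (ℕ; zero; suc; _+_; _≤_; _<_; _<ᵇ_; _≤ᵇ_; _≡ᵇ_; _∸_; z≤n; s≤s)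
open import Data.Nat.Properties
open import Algebra.Properties.CommutativeSemigroup +-commutativeSemigroup using () renaming (interchange to +-interchange)
open import Data.Product using (_×_; _,_; proj₁; proj₂; Σ)
open import Data.Sum using (_⊎_; inj₁; inj₂)
open import Function using (_∘_; id; flip)
open import Relation.Binary.Definitions using (tri<; tri≈; tri>)
open import Relation.Binary.PropositionalEquality using (_≡_; refl; sym; trans; cong; cong₂; subst; subst₂; module ≡-Reasoning)
open import Relation.Nullary using (¬_)
open import Relation.Nullary.Reflects using (Reflects; ofʸ; ofⁿ; fromEquivalence)

module _ {A : Set} where

  countB-++ : (p : A → Bool) (xs ys : List A) → countB p (xs ++ ys) ≡ countB p xs + countB p ys
  countB-++ p [] ys = refl
  countB-++ p (x ∷ xs) ys with p x
  ... | true  = cong suc (countB-++ p xs ys)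
  ... | false = countB-++ p xs ys

  countB-map : {B : Set} (p : B → Bool) (f : A → B) (xs : List A) → countB p (map f xs) ≡ countB (p ∘ f) xs
  countB-map p f [] = refl
  countB-map p f (x ∷ xs) with p (f x)
  ... | true  = cong suc (countB-map p f xs)
  ... | false = countB-map p f xs

  countB-cong : {p q : A → Bool} {xs : List A} → All (λ x → p x ≡ q x) xs → countB p xs ≡ countB q xs
  countB-cong [] = refl
  countB-cong {p} {q} {x ∷ xs} (px≡qx ∷ h) with p x | q x | px≡qx
  ... | true  | .true  | refl = cong suc (countB-cong h)
  ... | false | .false | refl = countB-cong h

  countB-mono : {p q : A → Bool} {xs : List A} → All (λ x → p x ≡ true → q x ≡ true) xs → countB p xs ≤ countB q xs
  countB-mono [] = z≤n
  countB-mono {p} {q} {x ∷ xs} (p⇒q ∷ h) with p x | q x | p⇒q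
  ... | true  | true  | _    = s≤s (countB-mono h)
  ... | true  | false | p⇒q′ with () ← p⇒q′ refl
  ... | false | true  | _    = m≤n⇒m≤1+n (countB-mono h)
  ... | false | false | _    = countB-mono h

  countB-mono-< : {p q : A → Bool} {xs : List A} {b : A} → All (λ x → p x ≡ true → q x ≡ true) xs →
                  b ∈ xs → p b ≡ false → q b ≡ true → countB p xs < countB q xs
  countB-mono-< {p} {q} (_ ∷ h) (here refl) pb qb rewrite pb | qb = s≤s (countB-mono h)
  countB-mono-< {p} {q} {x ∷ xs} (p⇒q ∷ h) (there b∈xs) pb qb with p x | q x | p⇒q
  ... | true  | true  | _    = s≤s (countB-mono-< h b∈xs pb qb)
  ... | true  | false | p⇒q′ with () ← p⇒q′ refl
  ... | false | true  | _    = m≤n⇒m≤1+n (countB-mono-< h b∈xs pb qb)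
  ... | false | false | _    = countB-mono-< h b∈xs pb qb

  countB-all : {p : A → Bool} (xs : List A) → All (λ x → p x ≡ true) xs → countB p xs ≡ length xs
  countB-all [] [] = refl
  countB-all (x ∷ xs) (px ∷ h) rewrite px = cong suc (countB-all xs h)

  countB-Any : {p : A → Bool} (xs : List A) → 0 < countB p xs → Any (λ x → p x ≡ true) xs
  countB-Any {p} (x ∷ xs) h with p x in px
  ... | true  = here px
  ... | false = there (countB-Any xs h)

  countB-↭ : (p : A → Bool) {xs ys : List A} → xs ↭ ys → countB p xs ≡ countB p ys
  countB-↭ p _↭_.refl = refl
  countB-↭ p (_↭_.prep x xs↭ys) with p x
  ... | true  = cong suc (countB-↭ p xs↭ys)
  ... | false = countB-↭ p xs↭ys
  countB-↭ p (_↭_.swap x y xs↭ys) with p x | p y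
  ... | true  | true  = cong (suc ∘ suc) (countB-↭ p xs↭ys)
  ... | true  | false = cong suc (countB-↭ p xs↭ys)
  ... | false | true  = cong suc (countB-↭ p xs↭ys)
  ... | false | false = countB-↭ p xs↭ys
  countB-↭ p (_↭_.trans xs↭ys ys↭zs) = trans (countB-↭ p xs↭ys) (countB-↭ p ys↭zs)

module _ {P : Set} where

  reflects-true : ∀ {b} → Reflects P b → P → b ≡ true
  reflects-true (ofʸ _)  p = refl
  reflects-true (ofⁿ ¬p) p = ⊥-elim (¬p p)

  reflects-false : ∀ {b} → Reflects P b → ¬ P → b ≡ false
  reflects-false (ofʸ p) ¬p = ⊥-elim (¬p p)
  reflects-false (ofⁿ _) ¬p = refl

  reflects-invert : ∀ {b} → Reflects P b → b ≡ true → P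
  reflects-invert (ofʸ p) _ = p

false≢true : false ≡ true → ⊥
false≢true ()

≡ᵇ-reflects-≡ : ∀ m n → Reflects (m ≡ n) (m ≡ᵇ n)
≡ᵇ-reflects-≡ m n = fromEquivalence (≡ᵇ⇒≡ m n) (≡⇒≡ᵇ m n)

module _ {m n : ℕ} where

  <⇒<ᵇ≡true : m < n → (m <ᵇ n) ≡ true
  <⇒<ᵇ≡true = reflects-true (<ᵇ-reflects-< m n)

  ≮⇒<ᵇ≡false : ¬ m < n → (m <ᵇ n) ≡ false
  ≮⇒<ᵇ≡false = reflects-false (<ᵇ-reflects-< m n)

  <ᵇ≡true⇒< : (m <ᵇ n) ≡ true → m < n
  <ᵇ≡true⇒< = reflects-invert (<ᵇ-reflects-< m n)

  ≤⇒≤ᵇ≡true : m ≤ n → (m ≤ᵇ n) ≡ true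
  ≤⇒≤ᵇ≡true = reflects-true (≤ᵇ-reflects-≤ m n)

  ≰⇒≤ᵇ≡false : ¬ m ≤ n → (m ≤ᵇ n) ≡ false
  ≰⇒≤ᵇ≡false = reflects-false (≤ᵇ-reflects-≤ m n)

  ≤ᵇ≡true⇒≤ : (m ≤ᵇ n) ≡ true → m ≤ n
  ≤ᵇ≡true⇒≤ = reflects-invert (≤ᵇ-reflects-≤ m n)

  ≡⇒≡ᵇ≡true : m ≡ n → (m ≡ᵇ n) ≡ true
  ≡⇒≡ᵇ≡true = reflects-true (≡ᵇ-reflects-≡ m n)

  ≡ᵇ≡true⇒≡ : (m ≡ᵇ n) ≡ true → m ≡ n
  ≡ᵇ≡true⇒≡ = reflects-invert (≡ᵇ-reflects-≡ m n)

Cell : Set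
Cell = ℕ × ℕ × ℕ

rowOf colOf val : Cell → ℕ
rowOf (i , _ , _) = i
colOf (_ , j , _) = j
val   (_ , _ , v) = v

stdBefore : Cell → Cell → Bool
stdBefore c' c = (val c' <ᵇ val c) ∨ ((val c' ≡ᵇ val c) ∧ precStd (rowOf c') (colOf c') (rowOf c) (colOf c))

infix 4 _≼_

data _≼_ (c' c : Cell) : Set where
  ≼-val : val c' < val c → c' ≼ c
  ≼-col : val c' ≡ val c → colOf c < colOf c' → c' ≼ c
  ≼-row : val c' ≡ val c → colOf c' ≡ colOf c → rowOf c' ≤ rowOf c → c' ≼ c

stdBefore-sound : (c' c : Cell) → stdBefore c' c ≡ true → c' ≼ c
stdBefore-sound c' c h with val c' <ᵇ val c in v<
... | true = ≼-val (<ᵇ≡true⇒< v<)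
... | false with val c' ≡ᵇ val c in v≡
...   | false with () ← h
...   | true with colOf c <ᵇ colOf c' in col<
...     | true = ≼-col (≡ᵇ≡true⇒≡ v≡) (<ᵇ≡true⇒< col<)
...     | false with colOf c' ≡ᵇ colOf c in col≡
...       | false with () ← h
...       | true with rowOf c' ≤ᵇ rowOf c in row≤
...         | false with () ← h
...         | true = ≼-row (≡ᵇ≡true⇒≡ v≡) (≡ᵇ≡true⇒≡ col≡) (≤ᵇ≡true⇒≤ row≤)

stdBefore-complete : (c' c : Cell) → c' ≼ c → stdBefore c' c ≡ true
stdBefore-complete c' c (≼-val v<) rewrite <⇒<ᵇ≡true v< = refl
stdBefore-complete c' c (≼-col v≡ col<)
  rewrite ≮⇒<ᵇ≡false (<-irrefl v≡) | ≡⇒≡ᵇ≡true v≡ | <⇒<ᵇ≡true col< = refl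
stdBefore-complete c' c (≼-row v≡ col≡ row≤)
  rewrite ≮⇒<ᵇ≡false (<-irrefl v≡) | ≡⇒≡ᵇ≡true v≡ | ≮⇒<ᵇ≡false (<-irrefl (sym col≡))
        | ≡⇒≡ᵇ≡true col≡ | ≤⇒≤ᵇ≡true row≤ = refl

stdBefore-false : (c' c : Cell) → ¬ c' ≼ c → stdBefore c' c ≡ false
stdBefore-false c' c c'⋠c with stdBefore c' c in h
... | true  = ⊥-elim (c'⋠c (stdBefore-sound c' c h))
... | false = refl

≼-refl : (c : Cell) → c ≼ c
≼-refl c = ≼-row refl refl ≤-refl

≼-trans : {a b c : Cell} → a ≼ b → b ≼ c → a ≼ c
≼-trans (≼-val p) q = ≼-val (<-≤-trans p (≼⇒val≤ q))
  where
  ≼⇒val≤ : {x y : Cell} → x ≼ y → val x ≤ val y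
  ≼⇒val≤ (≼-val p) = <⇒≤ p
  ≼⇒val≤ (≼-col e _) = ≤-reflexive e
  ≼⇒val≤ (≼-row e _ _) = ≤-reflexive e
≼-trans (≼-col e p) (≼-val q) = ≼-val (subst (_< _) (sym e) q)
≼-trans (≼-col e p) (≼-col e' q) = ≼-col (trans e e') (<-trans q p)
≼-trans (≼-col e p) (≼-row e' f _) = ≼-col (trans e e') (subst (_< _) f p)
≼-trans (≼-row e f r) (≼-val q) = ≼-val (subst (_< _) (sym e) q)
≼-trans (≼-row e f r) (≼-col e' q) = ≼-col (trans e e') (subst (_ <_) (sym f) q)
≼-trans (≼-row e f r) (≼-row e' f' r') = ≼-row (trans e e') (trans f f') (≤-trans r r')

val<⇒⋡ : {a b : Cell} → val a < val b → ¬ b ≼ a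
val<⇒⋡ a<b (≼-val b<a) = <-asym a<b b<a
val<⇒⋡ a<b (≼-col e _) = <-irrefl (sym e) a<b
val<⇒⋡ a<b (≼-row e _ _) = <-irrefl (sym e) a<b

module _ {A : Set} where

  lookupMaybe : List A → ℕ → Maybe A
  lookupMaybe []       _       = nothing
  lookupMaybe (x ∷ xs) zero    = just x
  lookupMaybe (x ∷ xs) (suc k) = lookupMaybe xs k

  columnAt : ℕ → List (List A) → List A
  columnAt k []       = []
  columnAt k (r ∷ rs) = fromMaybe (lookupMaybe r k) ++ columnAt k rs

  lastBelow : (A → ℕ) → List A → A → Bool
  lastBelow κ r e = Maybe.maybe′ (λ x → κ x <ᵇ κ e) false (last r)

  accepts : (A → ℕ) → ℕ → A → List A → Bool
  accepts κ k e r = (length r ≡ᵇ k) ∧ lastBelow κ r e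

  placeTopDownBy : (A → ℕ) → ℕ → A → List (List A) → List (List A)
  placeTopDownBy κ k e []       = []
  placeTopDownBy κ k e (r ∷ rs) =
    if accepts κ k e r then (r ++ [ e ]) ∷ rs else r ∷ placeTopDownBy κ k e rs

  placeAllTopDownBy : (A → ℕ) → ℕ → List (List A) → List A → List (List A)
  placeAllTopDownBy κ k = foldl (λ rs e → placeTopDownBy κ k e rs)

module _ {A : Set} where

  open import Algebra.Properties.CommutativeSemigroup
    (Algebra.CommutativeMonoid.commutativeSemigroup (↭.++-commutativeMonoid {A = A}))
    using (interchange)

  columnsUpTo : ℕ → List (List A) → List A
  columnsUpTo zero    X = []
  columnsUpTo (suc n) X = columnsUpTo n X ++ columnAt n X

  take-suc-lookupMaybe : (n : ℕ) (r : List A) → take (suc n) r ≡ take n r ++ fromMaybe (lookupMaybe r n)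
  take-suc-lookupMaybe zero    []      = refl
  take-suc-lookupMaybe (suc n) []      = refl
  take-suc-lookupMaybe zero    (x ∷ r) = refl
  take-suc-lookupMaybe (suc n) (x ∷ r) = cong (x ∷_) (take-suc-lookupMaybe n r)

  concat-take-suc : (n : ℕ) (X : List (List A)) →
                    concat (map (take (suc n)) X) ↭ concat (map (take n) X) ++ columnAt n X
  concat-take-suc n []       = ↭-refl
  concat-take-suc n (r ∷ rs) = begin
    take (suc n) r ++ concat (map (take (suc n)) rs)
      ≡⟨ cong (_++ _) (take-suc-lookupMaybe n r) ⟩
    (take n r ++ fromMaybe (lookupMaybe r n)) ++ concat (map (take (suc n)) rs)
      ↭⟨ ↭.++⁺ˡ (take n r ++ _) (concat-take-suc n rs) ⟩
    (take n r ++ fromMaybe (lookupMaybe r n)) ++ (concat (map (take n) rs) ++ columnAt n rs)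
      ↭⟨ interchange (take n r) _ _ _ ⟩
    (take n r ++ concat (map (take n) rs)) ++ (fromMaybe (lookupMaybe r n) ++ columnAt n rs) ∎
    where open PermutationReasoning

  columnsUpTo-↭ : (n : ℕ) (X : List (List A)) → columnsUpTo n X ↭ concat (map (take n) X)
  columnsUpTo-↭ zero    X = ↭-reflexive (sym (concat-take-zero X))
    where
    concat-take-zero : (X : List (List A)) → concat (map (take 0) X) ≡ []
    concat-take-zero []       = refl
    concat-take-zero (r ∷ rs) = concat-take-zero rs
  columnsUpTo-↭ (suc n) X =
    ↭-trans (↭.++⁺ʳ (columnAt n X) (columnsUpTo-↭ n X)) (↭-sym (concat-take-suc n X))

  columnsUpTo-concat : (n : ℕ) (X : List (List A)) → All (λ r → length r ≤ n) X → columnsUpTo n X ↭ concat X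
  columnsUpTo-concat n X short = ↭-trans (columnsUpTo-↭ n X) (↭-reflexive (cong concat (take-rows X short)))
    where
    take-rows : (X : List (List A)) → All (λ r → length r ≤ n) X → map (take n) X ≡ X
    take-rows []       []         = refl
    take-rows (r ∷ rs) (r≤ ∷ h) = cong₂ _∷_ (List.take-all n r r≤) (take-rows rs h)

module _ {A : Set} where

  lookupMaybe-++-< : (r : List A) (e : A) (j : ℕ) → j < length r → lookupMaybe (r ++ [ e ]) j ≡ lookupMaybe r j
  lookupMaybe-++-< (x ∷ r) e zero    _         = refl
  lookupMaybe-++-< (x ∷ r) e (suc j) (s≤s j<) = lookupMaybe-++-< r e j j<

  lookupMaybe-++-length : (r : List A) (e : A) → lookupMaybe (r ++ [ e ]) (length r) ≡ just e
  lookupMaybe-++-length []      e = refl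
  lookupMaybe-++-length (x ∷ r) e = lookupMaybe-++-length r e

  lookupMaybe-++⁻ : (r : List A) (e : A) (j : ℕ) {x : A} → lookupMaybe (r ++ [ e ]) j ≡ just x →
                    (lookupMaybe r j ≡ just x) ⊎ ((j ≡ length r) × (x ≡ e))
  lookupMaybe-++⁻ []      e zero    refl = inj₂ (refl , refl)
  lookupMaybe-++⁻ (y ∷ r) e zero    h    = inj₁ h
  lookupMaybe-++⁻ (y ∷ r) e (suc j) h with lookupMaybe-++⁻ r e j h
  ... | inj₁ old          = inj₁ old
  ... | inj₂ (j≡ , x≡e) = inj₂ (cong suc j≡ , x≡e)

  lookupMaybe-≥ : (r : List A) (j : ℕ) → length r ≤ j → lookupMaybe r j ≡ nothing
  lookupMaybe-≥ []      j       _         = refl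
  lookupMaybe-≥ (x ∷ r) (suc j) (s≤s r≤) = lookupMaybe-≥ r j r≤

  lookupMaybe-just⇒< : (r : List A) (j : ℕ) {x : A} → lookupMaybe r j ≡ just x → j < length r
  lookupMaybe-just⇒< (y ∷ r) zero    _ = s≤s z≤n
  lookupMaybe-just⇒< (y ∷ r) (suc j) h = s≤s (lookupMaybe-just⇒< r j h)

  lookupMaybe-nothing⇒≥ : (r : List A) (j : ℕ) → lookupMaybe r j ≡ nothing → length r ≤ j
  lookupMaybe-nothing⇒≥ []      j       _ = z≤n
  lookupMaybe-nothing⇒≥ (x ∷ r) (suc j) h = s≤s (lookupMaybe-nothing⇒≥ r j h)

  last≡lookupMaybe : (r : List A) (m : ℕ) → length r ≡ suc m → last r ≡ lookupMaybe r m
  last≡lookupMaybe (x ∷ [])    zero    refl = refl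
  last≡lookupMaybe (x ∷ y ∷ r) (suc m) h    = last≡lookupMaybe (y ∷ r) m (suc-injective h)

  length-∷ʳ : (r : List A) (e : A) → length (r ++ [ e ]) ≡ suc (length r)
  length-∷ʳ r e = trans (List.length-++ r) (+-comm (length r) 1)

  columnAt-short : (j : ℕ) (S : List (List A)) → All (λ r → length r ≤ j) S → columnAt j S ≡ []
  columnAt-short j []       []         = refl
  columnAt-short j (r ∷ rs) (r≤ ∷ h) rewrite lookupMaybe-≥ r j r≤ = columnAt-short j rs h

  columnAt-++ : (j : ℕ) (X Y : List (List A)) → columnAt j (X ++ Y) ≡ columnAt j X ++ columnAt j Y
  columnAt-++ j []       Y = refl
  columnAt-++ j (r ∷ X) Y =
    trans (cong (fromMaybe (lookupMaybe r j) ++_) (columnAt-++ j X Y))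
          (sym (List.++-assoc (fromMaybe (lookupMaybe r j)) (columnAt j X) (columnAt j Y)))

  columnAt-reverse : (j : ℕ) (X : List (List A)) → columnAt j (reverse X) ↭ columnAt j X
  columnAt-reverse j []      = ↭-refl
  columnAt-reverse j (r ∷ X) = begin
    columnAt j (reverse (r ∷ X))                    ≡⟨ cong (columnAt j) (List.unfold-reverse r X) ⟩
    columnAt j (reverse X ++ [ r ])                 ≡⟨ columnAt-++ j (reverse X) [ r ] ⟩
    columnAt j (reverse X) ++ columnAt j [ r ]      ↭⟨ ↭.++-comm (columnAt j (reverse X)) _ ⟩
    columnAt j [ r ] ++ columnAt j (reverse X)      ≡⟨ cong (_++ columnAt j (reverse X)) (List.++-identityʳ (fromMaybe (lookupMaybe r j))) ⟩
    fromMaybe (lookupMaybe r j) ++ columnAt j (reverse X) ↭⟨ ↭.++⁺ˡ _ (columnAt-reverse j X) ⟩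
    columnAt j (r ∷ X)                              ∎
    where open PermutationReasoning

  concat-reverse : (X : List (List A)) → concat (reverse X) ↭ concat X
  concat-reverse []      = ↭-refl
  concat-reverse (r ∷ X) = begin
    concat (reverse (r ∷ X))             ≡⟨ cong concat (List.unfold-reverse r X) ⟩
    concat (reverse X ++ [ r ])          ≡⟨ List.concat-++ (reverse X) [ r ] ⟨
    concat (reverse X) ++ r ++ []        ↭⟨ ↭.++-comm (concat (reverse X)) _ ⟩
    (r ++ []) ++ concat (reverse X)      ≡⟨ cong (_++ _) (List.++-identityʳ r) ⟩
    r ++ concat (reverse X)              ↭⟨ ↭.++⁺ˡ r (concat-reverse X) ⟩
    concat (r ∷ X)                       ∎
    where open PermutationReasoning

  All-reverse : {P : A → Set} {xs : List A} → All P xs → All P (reverse xs)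
  All-reverse {xs = xs} = ↭.All-resp-↭ (↭-sym (↭.↭-reverse xs))

  AllPairs-reverse : {R : A → A → Set} (xs : List A) → AllPairs R xs → AllPairs (flip R) (reverse xs)
  AllPairs-reverse []       []         = []
  AllPairs-reverse (x ∷ xs) (x-R ∷ h) rewrite List.unfold-reverse x xs =
    AllPairsₚ.++⁺ (AllPairs-reverse xs h) ([] ∷ []) (All-reverse (All.map (_∷ []) x-R))

  AllPairs-++⁻ʳ : {R : A → A → Set} (xs : List A) {ys : List A} → AllPairs R (xs ++ ys) → AllPairs R ys
  AllPairs-++⁻ʳ []       h       = h
  AllPairs-++⁻ʳ (x ∷ xs) (_ ∷ h) = AllPairs-++⁻ʳ xs h

  AllPairs-before : {R : A → A → Set} (xs : List A) {y : A} {ys : List A} →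
                    AllPairs R (xs ++ y ∷ ys) → All (λ x → R x y) xs
  AllPairs-before []       _          = []
  AllPairs-before (x ∷ xs) (x-R ∷ h) = All.head (Allₚ.++⁻ʳ xs x-R) ∷ AllPairs-before xs h

module _ {A : Set} (κ : A → ℕ) (k : ℕ) (e : A) where

  accepts⇒length : (r : List A) → accepts κ k e r ≡ true → length r ≡ k
  accepts⇒length r h with length r ≡ᵇ k in len≡
  ... | true  = ≡ᵇ≡true⇒≡ len≡

  accepts⇒lastBelow : (r : List A) → accepts κ k e r ≡ true → lastBelow κ r e ≡ true
  accepts⇒lastBelow r h with length r ≡ᵇ k
  ... | true = h

  All-placeTopDownBy : {P : List A → Set} (S : List (List A)) → All P S →
                       (∀ r → accepts κ k e r ≡ true → P r → P (r ++ [ e ])) → All P (placeTopDownBy κ k e S)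
  All-placeTopDownBy []       []       step = []
  All-placeTopDownBy (r ∷ rs) (pr ∷ h) step with accepts κ k e r in acc
  ... | true  = step r acc pr ∷ h
  ... | false = pr ∷ All-placeTopDownBy rs h step

column-cons : (k : ℕ) (r : List ℕ) (rs : Filling) → column k (r ∷ rs) ≡ fromMaybe (lookupM r k) ++ column k rs
column-cons k r rs with lookupM r k
... | just x  = refl
... | nothing = refl

module _ {A : Set} (f : A → ℕ) where

  lookupM-map : (r : List A) (k : ℕ) → lookupM (map f r) k ≡ Maybe.map f (lookupMaybe r k)
  lookupM-map []      k       = refl
  lookupM-map (x ∷ r) zero    = refl
  lookupM-map (x ∷ r) (suc k) = lookupM-map r k

  column-map : (k : ℕ) (X : List (List A)) → column k (map (map f) X) ≡ map f (columnAt k X)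
  column-map k []       = refl
  column-map k (r ∷ rs) rewrite column-cons k (map f r) (map (map f) rs) | lookupM-map r k
    with lookupMaybe r k
  ... | just x  = cong (f x ∷_) (column-map k rs)
  ... | nothing = column-map k rs

  last-map : (r : List A) → last (map f r) ≡ Maybe.map f (last r)
  last-map []          = refl
  last-map (x ∷ [])    = refl
  last-map (x ∷ y ∷ r) = last-map (y ∷ r)

  lastLt-map : (r : List A) (e : A) → lastLt (map f r) (f e) ≡ lastBelow f r e
  lastLt-map r e with last (map f r) | last-map r
  ... | _ | refl with last r
  ...   | just x  = refl
  ...   | nothing = refl

  placeTopDown-map : (κ : A → ℕ) (k : ℕ) (e : A) (S : List (List A)) →
                     All (λ r → length r ≡ k → lastBelow κ r e ≡ lastBelow f r e) S →
                     map (map f) (placeTopDownBy κ k e S) ≡ placeTopDown k (f e) (map (map f) S)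
  placeTopDown-map κ k e [] [] = refl
  placeTopDown-map κ k e (r ∷ rs) (agree ∷ h) rewrite List.length-map f r | lastLt-map r e
    with length r ≡ᵇ k in len≡
  ... | false = cong (map f r ∷_) (placeTopDown-map κ k e rs h)
  ... | true rewrite agree (≡ᵇ≡true⇒≡ len≡) with lastBelow f r e
  ...   | true  = cong (_∷ map (map f) rs) (List.map-++ f r [ e ])
  ...   | false = cong (map f r ∷_) (placeTopDown-map κ k e rs h)

foldl-place : (k : ℕ) (R : Filling) (es : List ℕ) →
              foldl (λ rs e → place k e rs) R es ≡ reverse (foldl (λ rs e → placeTopDown k e rs) (reverse R) es)
foldl-place k R []       = sym (List.reverse-involutive R)
foldl-place k R (e ∷ es) rewrite foldl-place k (place k e R) es
                               | List.reverse-involutive (placeTopDown k e (reverse R)) = refl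

sortAsc-id : (xs : List ℕ) → AllPairs _≤_ xs → sortAsc xs ≡ xs
sortAsc-id []       []       = refl
sortAsc-id (x ∷ xs) (x≤ ∷ h) rewrite sortAsc-id xs h = insert-min xs x≤
  where
  insert-min : (ys : List ℕ) → All (x ≤_) ys → insertAsc x ys ≡ x ∷ ys
  insert-min []       _         = refl
  insert-min (y ∷ ys) (x≤y ∷ _) rewrite ≤⇒≤ᵇ≡true x≤y = refl

lookupM-suc-strict : {r : List ℕ} {k c : ℕ} → Linked _<_ r → lookupM r (suc k) ≡ just c →
                     Σ ℕ λ d → (lookupM r k ≡ just d) × (d < c)
lookupM-suc-strict {x ∷ y ∷ r} {zero}  (x<y Linked.∷ _) refl = x , refl , x<y
lookupM-suc-strict {x ∷ y ∷ r} {suc k} (_ Linked.∷ h)   e    = lookupM-suc-strict h e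

count≤-column-suc≤count<-column : (v k : ℕ) (X : Filling) → All (Linked _<_) X →
  countB (_≤ᵇ v) (column (suc k) X) ≤ countB (_<ᵇ v) (column k X)
count≤-column-suc≤count<-column v k []       []       = z≤n
count≤-column-suc≤count<-column v k (r ∷ rs) (r< ∷ h)
  rewrite column-cons (suc k) r rs | column-cons k r rs
        | countB-++ (_≤ᵇ v) (fromMaybe (lookupM r (suc k))) (column (suc k) rs)
        | countB-++ (_<ᵇ v) (fromMaybe (lookupM r k)) (column k rs)
  = +-mono-≤ inRow (count≤-column-suc≤count<-column v k rs h)
  where
  inRow : countB (_≤ᵇ v) (fromMaybe (lookupM r (suc k))) ≤ countB (_<ᵇ v) (fromMaybe (lookupM r k))
  inRow with lookupM r (suc k) in e
  ... | nothing = z≤n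
  ... | just c with lookupM-suc-strict r< e
  ...   | d , e' , d<c rewrite e' with c ≤ᵇ v in c≤v
  ...     | false = z≤n
  ...     | true rewrite <⇒<ᵇ≡true (<-≤-trans d<c (≤ᵇ≡true⇒≤ c≤v)) = ≤-refl

below-lookupM : {r r' : List ℕ} {k y : ℕ} → Below r r' → lookupM r' k ≡ just y →
                Σ ℕ λ x → (lookupM r k ≡ just x) × (x ≤ y)
below-lookupM {x ∷ _} {_ ∷ _} {zero}  (below-∷ x≤y _) refl = x , refl , x≤y
below-lookupM {_ ∷ _} {_ ∷ _} {suc k} (below-∷ _ b)   e    = below-lookupM b e

column-above-empty : (k : ℕ) (r : List ℕ) (rs : Filling) → Linked Below (r ∷ rs) →
                     lookupM r k ≡ nothing → column k rs ≡ []
column-above-empty k r []        _                e = refl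
column-above-empty k r (r' ∷ rs) (b Linked.∷ h) e with lookupM r' k in e'
... | nothing = column-above-empty k r' rs h e'
... | just y with below-lookupM b e'
...   | _ , e″ , _ with () ← trans (sym e) e″

column-above-≥ : (k : ℕ) (r : List ℕ) (rs : Filling) (x : ℕ) → Linked Below (r ∷ rs) →
                 lookupM r k ≡ just x → All (x ≤_) (column k rs)
column-above-≥ k r []        x _                e = []
column-above-≥ k r (r' ∷ rs) x (b Linked.∷ h) e with lookupM r' k in e'
... | nothing rewrite column-above-empty k r' rs h e' = []
... | just y with below-lookupM b e'
...   | x' , e″ , x'≤y with refl ← trans (sym e) e″ =
  x'≤y ∷ All.map (≤-trans x'≤y) (column-above-≥ k r' rs y h e')

column-sorted : (k : ℕ) (X : Filling) → Linked Below X → AllPairs _≤_ (column k X)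
column-sorted k []       _ = []
column-sorted k (r ∷ rs) h rewrite column-cons k r rs with lookupM r k in e
... | nothing = column-sorted k rs (Linked.tail h)
... | just x  = column-above-≥ k r rs x h e ∷ column-sorted k rs (Linked.tail h)

rows-bounded : (X : Filling) → Linked Below X → All (λ r → length r ≤ numCols X) X
rows-bounded []       _ = []
rows-bounded (r ∷ rs) h = ≤-refl ∷ below r rs h
  where
  below-length : {r r' : List ℕ} → Below r r' → length r' ≤ length r
  below-length below-[]      = z≤n
  below-length (below-∷ _ b) = s≤s (below-length b)

  below : (r : List ℕ) (rs : Filling) → Linked Below (r ∷ rs) → All (λ r' → length r' ≤ length r) rs
  below r []        _                = []
  below r (r' ∷ rs) (b Linked.∷ h) =
    below-length b ∷ All.map (λ p → ≤-trans p (below-length b)) (below r' rs h)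

tagRowsFrom : ℕ → Filling → List (List Cell)
tagRowsFrom i []       = []
tagRowsFrom i (r ∷ rs) = cellsRow i 0 r ∷ tagRowsFrom (suc i) rs

concat-tagRowsFrom : (i : ℕ) (X : Filling) → concat (tagRowsFrom i X) ≡ cellsFrom i X
concat-tagRowsFrom i []       = refl
concat-tagRowsFrom i (r ∷ rs) = cong (cellsRow i 0 r ++_) (concat-tagRowsFrom (suc i) rs)

map-val-cellsRow : (i j : ℕ) (r : List ℕ) → map val (cellsRow i j r) ≡ r
map-val-cellsRow i j []      = refl
map-val-cellsRow i j (x ∷ r) = cong (x ∷_) (map-val-cellsRow i (suc j) r)

map-val-tagRowsFrom : (i : ℕ) (X : Filling) → map (map val) (tagRowsFrom i X) ≡ X
map-val-tagRowsFrom i []       = refl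
map-val-tagRowsFrom i (r ∷ rs) = cong₂ _∷_ (map-val-cellsRow i 0 r) (map-val-tagRowsFrom (suc i) rs)

module _ (f : ℕ → ℕ → ℕ → ℕ) (g : Cell → ℕ) (f≗g : ∀ a b c → f a b c ≡ g (a , b , c)) where

  relabelRow-cellsRow : (i j : ℕ) (r : List ℕ) → relabelRow f i j r ≡ map g (cellsRow i j r)
  relabelRow-cellsRow i j []      = refl
  relabelRow-cellsRow i j (x ∷ r) = cong₂ _∷_ (f≗g i j x) (relabelRow-cellsRow i (suc j) r)

  relabelFrom-tagRowsFrom : (i : ℕ) (X : Filling) → relabelFrom f i X ≡ map (map g) (tagRowsFrom i X)
  relabelFrom-tagRowsFrom i []       = refl
  relabelFrom-tagRowsFrom i (r ∷ rs) =
    cong₂ _∷_ (relabelRow-cellsRow i 0 r) (relabelFrom-tagRowsFrom (suc i) rs)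

length-cellsRow : (i j : ℕ) (r : List ℕ) → length (cellsRow i j r) ≡ length r
length-cellsRow i j []      = refl
length-cellsRow i j (x ∷ r) = cong suc (length-cellsRow i (suc j) r)

numCols-tagRowsFrom : (f : Cell → ℕ) (i : ℕ) (X : Filling) → numCols (map (map f) (tagRowsFrom i X)) ≡ numCols X
numCols-tagRowsFrom f i []       = refl
numCols-tagRowsFrom f i (r ∷ rs) = trans (List.length-map f (cellsRow i 0 r)) (length-cellsRow i 0 r)

lookupMaybe-cellsRow : (i j : ℕ) (r : List ℕ) (k : ℕ) {x : Cell} → lookupMaybe (cellsRow i j r) k ≡ just x →
                       (rowOf x ≡ i) × (colOf x ≡ j + k) × (x ∈ cellsRow i j r)
lookupMaybe-cellsRow i j (y ∷ r) zero    refl = refl , sym (+-identityʳ j) , here refl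
lookupMaybe-cellsRow i j (y ∷ r) (suc k) e with lookupMaybe-cellsRow i (suc j) r k e
... | row≡ , col≡ , x∈ = row≡ , trans col≡ (sym (+-suc j k)) , there x∈

columnAt-tagRowsFrom : (k i : ℕ) (X : Filling) →
  All (λ x → (colOf x ≡ k) × (x ∈ cellsFrom i X) × (i ≤ rowOf x)) (columnAt k (tagRowsFrom i X))
columnAt-tagRowsFrom k i []       = []
columnAt-tagRowsFrom k i (r ∷ rs) = Allₚ.++⁺ inRow (All.map later (columnAt-tagRowsFrom k (suc i) rs))
  where
  inRow : All (λ x → (colOf x ≡ k) × (x ∈ cellsFrom i (r ∷ rs)) × (i ≤ rowOf x))
              (fromMaybe (lookupMaybe (cellsRow i 0 r) k))
  inRow with lookupMaybe (cellsRow i 0 r) k in e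
  ... | nothing = []
  ... | just x with lookupMaybe-cellsRow i 0 r k e
  ...   | row≡ , col≡ , x∈ = (col≡ , ∈-++⁺ˡ x∈ , ≤-reflexive (sym row≡)) ∷ []
  later : ∀ {x} → (colOf x ≡ k) × (x ∈ cellsFrom (suc i) rs) × (suc i ≤ rowOf x) →
          (colOf x ≡ k) × (x ∈ cellsFrom i (r ∷ rs)) × (i ≤ rowOf x)
  later (col≡ , x∈ , i<) = col≡ , ∈-++⁺ʳ (cellsRow i 0 r) x∈ , <⇒≤ i<

columnAt-tagRowsFrom-rows : (k i : ℕ) (X : Filling) →
  AllPairs (λ a b → rowOf a < rowOf b) (columnAt k (tagRowsFrom i X))
columnAt-tagRowsFrom-rows k i []       = []
columnAt-tagRowsFrom-rows k i (r ∷ rs) with lookupMaybe (cellsRow i 0 r) k in e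
... | nothing = columnAt-tagRowsFrom-rows k (suc i) rs
... | just x  = All.map below (columnAt-tagRowsFrom k (suc i) rs) ∷ columnAt-tagRowsFrom-rows k (suc i) rs
  where
  below : ∀ {y} → (colOf y ≡ k) × (y ∈ cellsFrom (suc i) rs) × (suc i ≤ rowOf y) → rowOf x < rowOf y
  below (_ , _ , i<) = subst (_< _) (sym (proj₁ (lookupMaybe-cellsRow i 0 r k e))) i<

-- For equal entries x below x' in column j of ρ T: st reads them in the order in which std reads
-- their source cells.
SourceOrder : ℕ → Cell → Cell → Set
SourceOrder zero    x x' = rowOf x < rowOf x'
SourceOrder (suc _) x x' = rowOf x' < rowOf x

TiesOrdered : List Cell → List Cell → Set
TiesOrdered r r' = ∀ j {x x'} → lookupMaybe r j ≡ just x → lookupMaybe r' j ≡ just x' → val x ≡ val x' → SourceOrder j x x'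

-- Row r, above r', could not have taken the entry that r' holds in column k (nor any equal one).
Refuses : ℕ → List Cell → List Cell → Set
Refuses k r r' = length r ≡ k → ∀ {x} → lookupMaybe r' k ≡ just x → lastBelow val r x ≡ false

lastBelow-val : (r : List Cell) {x y : Cell} → val x ≡ val y → lastBelow val r x ≡ lastBelow val r y
lastBelow-val r v≡ = cong (λ v → Maybe.maybe′ (λ z → val z <ᵇ v) false (last r)) v≡

All-fromMaybe : {A : Set} {P : A → Set} {m : Maybe A} → All P (fromMaybe m) → ∀ {x} → m ≡ just x → P x
All-fromMaybe (px ∷ []) refl = px

module Insertion (k : ℕ) (e : Cell) where

  private
    Accepts : List Cell → Set
    Accepts r = accepts val (suc k) e r ≡ true

  lookupMaybe-accepting : (r : List Cell) → Accepts r → lookupMaybe (r ++ [ e ]) (suc k) ≡ just e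
  lookupMaybe-accepting r acc =
    subst (λ j → lookupMaybe (r ++ [ e ]) j ≡ just e) (accepts⇒length val (suc k) e r acc) (lookupMaybe-++-length r e)

  lookupMaybe-accepting-empty : (r : List Cell) → Accepts r → lookupMaybe r (suc k) ≡ nothing
  lookupMaybe-accepting-empty r acc = lookupMaybe-≥ r (suc k) (≤-reflexive (accepts⇒length val (suc k) e r acc))

  ties-accepting : (r r' : List Cell) → Accepts r → TiesOrdered r' r → Refuses (suc k) r r' → TiesOrdered r' (r ++ [ e ])
  ties-accepting r r' acc ties refuses j {x} look look' v≡ with lookupMaybe-++⁻ r e j look'
  ... | inj₁ old = ties j look old v≡
  ... | inj₂ (refl , refl) = ⊥-elim (false≢true (trans (sym refused) accepted))
    where
    len : length r ≡ suc k
    len = accepts⇒length val (suc k) e r acc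
    refused : lastBelow val r x ≡ false
    refused = refuses len (subst (λ j → lookupMaybe r' j ≡ just x) len look)
    accepted : lastBelow val r x ≡ true
    accepted = trans (lastBelow-val r {x} {e} v≡) (accepts⇒lastBelow val (suc k) e r acc)

  ties-accepting-below : (r r'' : List Cell) → (∀ {x'} → lookupMaybe r (suc k) ≡ just x' → rowOf x' < rowOf e) →
                         Accepts r'' → TiesOrdered r'' r → TiesOrdered (r'' ++ [ e ]) r
  ties-accepting-below r r'' earlier acc ties j look look' v≡ with lookupMaybe-++⁻ r'' e j look
  ... | inj₁ old = ties j old look' v≡
  ... | inj₂ (refl , refl) rewrite accepts⇒length val (suc k) e r'' acc = earlier look'

  ties-placeTopDown : (S : List (List Cell)) → AllPairs (flip TiesOrdered) S → AllPairs (Refuses (suc k)) S →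
                      All (λ x → rowOf x < rowOf e) (columnAt (suc k) S) →
                      AllPairs (flip TiesOrdered) (placeTopDownBy val (suc k) e S)
  ties-placeTopDown []       []                []                  _       = []
  ties-placeTopDown (r ∷ rs) (ties-r ∷ ties) (refuses-r ∷ refuses) earlier with accepts val (suc k) e r in acc
  ... | true  = All.zipWith (λ {r'} (t , w) → ties-accepting r r' acc t w) (ties-r , refuses-r) ∷ ties
  ... | false = All-placeTopDownBy val (suc k) e rs ties-r
                  (λ r'' acc'' → ties-accepting-below r r'' (All-fromMaybe (Allₚ.++⁻ˡ _ earlier)) acc'')
                ∷ ties-placeTopDown rs ties refuses (Allₚ.++⁻ʳ _ earlier)

  refuses-placeTopDown : (S : List (List Cell)) → AllPairs (Refuses (suc k)) S →
                         AllPairs (Refuses (suc k)) (placeTopDownBy val (suc k) e S)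
  refuses-placeTopDown []       []                    = []
  refuses-placeTopDown (r ∷ rs) (refuses-r ∷ refuses) with accepts val (suc k) e r in acc
  ... | true  = All.tabulate (λ _ len → ⊥-elim (1+n≢n (trans (sym (cong suc (accepts⇒length val (suc k) e r acc)))
                                                              (trans (sym (length-∷ʳ r e)) len))))
                ∷ refuses
  ... | false = All-placeTopDownBy val (suc k) e rs refuses-r (λ r'' _ → refuses-∷ʳ r'') ∷ refuses-placeTopDown rs refuses
    where
    refuses-∷ʳ : (r'' : List Cell) → Refuses (suc k) r r'' → Refuses (suc k) r (r'' ++ [ e ])
    refuses-∷ʳ r'' refuses-r'' len look with lookupMaybe-++⁻ r'' e (suc k) look
    ... | inj₁ old      = refuses-r'' len old
    ... | inj₂ (_ , refl) rewrite len | ≡⇒≡ᵇ≡true {suc k} refl = acc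

  All-columnAt-placeTopDown : {P : Cell → Set} (S : List (List Cell)) → All P (columnAt (suc k) S) → P e →
                              All P (columnAt (suc k) (placeTopDownBy val (suc k) e S))
  All-columnAt-placeTopDown []       _ _  = []
  All-columnAt-placeTopDown (r ∷ rs) h pe with accepts val (suc k) e r in acc
  ... | true rewrite lookupMaybe-accepting r acc = pe ∷ Allₚ.++⁻ʳ (fromMaybe (lookupMaybe r (suc k))) h
  ... | false = Allₚ.++⁺ (Allₚ.++⁻ˡ _ h) (All-columnAt-placeTopDown rs (Allₚ.++⁻ʳ _ h) pe)

  columnAt-placeTopDown : (S : List (List Cell)) → Any Accepts S →
                          columnAt (suc k) (placeTopDownBy val (suc k) e S) ↭ e ∷ columnAt (suc k) S
  columnAt-placeTopDown (r ∷ rs) any with accepts val (suc k) e r in acc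
  ... | true rewrite lookupMaybe-accepting r acc | lookupMaybe-accepting-empty r acc = ↭-refl
  ... | false with any
  ...   | here acc′ with () ← trans (sym acc′) acc
  ...   | there any′ = ↭-trans (↭.++⁺ˡ _ (columnAt-placeTopDown rs any′))
                               (↭.shift e (fromMaybe (lookupMaybe r (suc k))) (columnAt (suc k) rs))

  columnAt-left-placeTopDown : (S : List (List Cell)) → columnAt k (placeTopDownBy val (suc k) e S) ≡ columnAt k S
  columnAt-left-placeTopDown []       = refl
  columnAt-left-placeTopDown (r ∷ rs) with accepts val (suc k) e r in acc
  ... | true  = cong (λ m → fromMaybe m ++ columnAt k rs)
                     (lookupMaybe-++-< r e k (≤-reflexive (sym (accepts⇒length val (suc k) e r acc))))
  ... | false = cong (fromMaybe (lookupMaybe r k) ++_) (columnAt-left-placeTopDown rs)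

  concat-placeTopDown : (S : List (List Cell)) → Any Accepts S → concat (placeTopDownBy val (suc k) e S) ↭ e ∷ concat S
  concat-placeTopDown (r ∷ rs) any with accepts val (suc k) e r in acc
  ... | true  = ↭-trans (↭-reflexive (List.++-assoc r [ e ] (concat rs))) (↭.shift e r (concat rs))
  ... | false with any
  ...   | here acc′ with () ← trans (sym acc′) acc
  ...   | there any′ = ↭-trans (↭.++⁺ˡ r (concat-placeTopDown rs any′)) (↭.shift e r (concat rs))

  ending-below-accepts : (r : List Cell) {d : Cell} → lookupMaybe r k ≡ just d → lookupMaybe r (suc k) ≡ nothing →
                         (val d <ᵇ val e) ≡ true → Accepts r
  ending-below-accepts r look look' d<e =
    accepts-of-length (≤-antisym (lookupMaybe-nothing⇒≥ r (suc k) look') (lookupMaybe-just⇒< r k look))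
    where
    accepts-of-length : length r ≡ suc k → Accepts r
    accepts-of-length len rewrite len | ≡⇒≡ᵇ≡true {suc k} refl | last≡lookupMaybe r k len | look = d<e

  -- An entry of column k below e either already has a right neighbour or its row accepts e.
  count<-left≤filled+accepting : (S : List (List Cell)) →
    countB (λ d → val d <ᵇ val e) (columnAt k S) ≤ length (columnAt (suc k) S) + countB (accepts val (suc k) e) S
  count<-left≤filled+accepting []       = z≤n
  count<-left≤filled+accepting (r ∷ rs) = begin
    countB below (left ++ columnAt k rs)
      ≡⟨ countB-++ below left (columnAt k rs) ⟩
    countB below left + countB below (columnAt k rs)
      ≤⟨ +-mono-≤ inRow (count<-left≤filled+accepting rs) ⟩
    (length here′ + countB acc [ r ]) + (length (columnAt (suc k) rs) + countB acc rs)
      ≡⟨ +-interchange (length here′) _ _ _ ⟩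
    (length here′ + length (columnAt (suc k) rs)) + (countB acc [ r ] + countB acc rs)
      ≡⟨ cong₂ _+_ (List.length-++ here′) (countB-++ acc [ r ] rs) ⟨
    length (here′ ++ columnAt (suc k) rs) + countB acc (r ∷ rs) ∎
    where
    open ≤-Reasoning
    below : Cell → Bool
    below d = val d <ᵇ val e
    acc : List Cell → Bool
    acc = accepts val (suc k) e
    left here′ : List Cell
    left  = fromMaybe (lookupMaybe r k)
    here′ = fromMaybe (lookupMaybe r (suc k))
    inRow : countB below left ≤ length here′ + countB acc [ r ]
    inRow with lookupMaybe r k in look
    ... | nothing = z≤n
    ... | just d with val d <ᵇ val e in d<e
    ...   | false = z≤n
    ...   | true with lookupMaybe r (suc k) in look'
    ...     | just _  = s≤s z≤n
    ...     | nothing rewrite ending-below-accepts r look look' d<e = ≤-refl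

module _ {A : Set} where

  cellsRow′ : ℕ → ℕ → List A → List (ℕ × ℕ × A)
  cellsRow′ i j []       = []
  cellsRow′ i j (x ∷ xs) = (i , j , x) ∷ cellsRow′ i (suc j) xs

  cellsFrom′ : ℕ → List (List A) → List (ℕ × ℕ × A)
  cellsFrom′ i []       = []
  cellsFrom′ i (r ∷ rs) = cellsRow′ i 0 r ++ cellsFrom′ (suc i) rs

  entry : ℕ × ℕ × A → A
  entry (_ , _ , x) = x

  map-entry-cellsFrom′ : (i : ℕ) (X : List (List A)) → map entry (cellsFrom′ i X) ≡ concat X
  map-entry-cellsFrom′ i []       = refl
  map-entry-cellsFrom′ i (r ∷ rs) =
    trans (List.map-++ entry (cellsRow′ i 0 r) (cellsFrom′ (suc i) rs))
          (cong₂ _++_ (map-entry-cellsRow′ i 0 r) (map-entry-cellsFrom′ (suc i) rs))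
    where
    map-entry-cellsRow′ : (i j : ℕ) (r : List A) → map entry (cellsRow′ i j r) ≡ r
    map-entry-cellsRow′ i j []      = refl
    map-entry-cellsRow′ i j (x ∷ r) = cong (x ∷_) (map-entry-cellsRow′ i (suc j) r)

  ∈-cellsRow′ : (i j : ℕ) (r : List A) {a b : ℕ} {x : A} → (a , b , x) ∈ cellsRow′ i j r →
                (a ≡ i) × Σ ℕ λ m → (b ≡ j + m) × (lookupMaybe r m ≡ just x)
  ∈-cellsRow′ i j (y ∷ r) (here refl) = refl , 0 , sym (+-identityʳ j) , refl
  ∈-cellsRow′ i j (y ∷ r) (there t∈) with ∈-cellsRow′ i (suc j) r t∈
  ... | a≡ , m , b≡ , look = a≡ , suc m , trans b≡ (sym (+-suc j m)) , look

  ∈-cellsFrom′ : (i : ℕ) (X : List (List A)) {a b : ℕ} {x : A} → (a , b , x) ∈ cellsFrom′ i X →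
                 (i ≤ a) × Σ (List A) λ r → (r ∈ X) × (lookupMaybe r b ≡ just x)
  ∈-cellsFrom′ i (r ∷ rs) t∈ with ∈-++⁻ (cellsRow′ i 0 r) t∈
  ... | inj₁ t∈r with ∈-cellsRow′ i 0 r t∈r
  ...   | refl , m , refl , look = ≤-refl , r , here refl , look
  ∈-cellsFrom′ i (r ∷ rs) t∈ | inj₂ t∈rs with ∈-cellsFrom′ (suc i) rs t∈rs
  ...   | i< , r' , r'∈ , look = <⇒≤ i< , r' , there r'∈ , look

valAt : ℕ × ℕ × Cell → Cell
valAt (a , b , x) = a , b , val x

cellsFrom-map-val : (i : ℕ) (X : List (List Cell)) → cellsFrom i (map (map val) X) ≡ map valAt (cellsFrom′ i X)
cellsFrom-map-val i []       = refl
cellsFrom-map-val i (r ∷ rs) =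
  trans (cong₂ _++_ (cellsRow-map-val i 0 r) (cellsFrom-map-val (suc i) rs))
        (sym (List.map-++ valAt (cellsRow′ i 0 r) (cellsFrom′ (suc i) rs)))
  where
  cellsRow-map-val : (i j : ℕ) (r : List Cell) → cellsRow i j (map val r) ≡ map valAt (cellsRow′ i j r)
  cellsRow-map-val i j []      = refl
  cellsRow-map-val i j (x ∷ r) = cong (_ ∷_) (cellsRow-map-val i (suc j) r)

module _ (f : ℕ → ℕ → ℕ → ℕ) (h : Cell → ℕ) where

  relabelRow-map-val : (i j : ℕ) (r : List Cell) → (∀ a b x → (a , b , x) ∈ cellsRow′ i j r → f a b (val x) ≡ h x) →
                       relabelRow f i j (map val r) ≡ map h r
  relabelRow-map-val i j []      f≗h = refl
  relabelRow-map-val i j (x ∷ r) f≗h =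
    cong₂ _∷_ (f≗h i j x (here refl)) (relabelRow-map-val i (suc j) r (λ a b y y∈ → f≗h a b y (there y∈)))

  relabelFrom-map-val : (i : ℕ) (X : List (List Cell)) → (∀ a b x → (a , b , x) ∈ cellsFrom′ i X → f a b (val x) ≡ h x) →
                        relabelFrom f i (map (map val) X) ≡ map (map h) X
  relabelFrom-map-val i []       f≗h = refl
  relabelFrom-map-val i (r ∷ rs) f≗h =
    cong₂ _∷_ (relabelRow-map-val i 0 r (λ a b x x∈ → f≗h a b x (∈-++⁺ˡ x∈)))
              (relabelFrom-map-val (suc i) rs (λ a b x x∈ → f≗h a b x (∈-++⁺ʳ (cellsRow′ i 0 r) x∈)))

stBefore : Cell → Cell → Bool
stBefore c' c = (val c' <ᵇ val c) ∨ ((val c' ≡ᵇ val c) ∧ precSt (rowOf c') (colOf c') (rowOf c) (colOf c))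

stRowBefore : ℕ → ℕ → ℕ → Bool
stRowBefore a' a b = if b ≡ᵇ 0 then a' ≤ᵇ a else a ≤ᵇ a'

stBefore≡stdBefore : (a b a' b' : ℕ) (x x' : Cell) → colOf x ≡ b → colOf x' ≡ b' →
                     (val x' ≡ val x → b' ≡ b → stRowBefore a' a b ≡ (rowOf x' ≤ᵇ rowOf x)) →
                     stBefore (a' , b' , val x') (a , b , val x) ≡ stdBefore x' x
stBefore≡stdBefore a _ a' _ (i , j , v) (i' , j' , v') refl refl rows with v' <ᵇ v
... | true  = refl
... | false with v' ≡ᵇ v in v≡
...   | false = refl
...   | true with j <ᵇ j'
...     | true  = refl
...     | false with j' ≡ᵇ j in j≡
...       | false = refl
...       | true  = rows (≡ᵇ≡true⇒≡ v≡) (≡ᵇ≡true⇒≡ j≡)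

stRowBefore-source : (a a' j : ℕ) (x x' : Cell) → a < a' → SourceOrder j x x' → stRowBefore a' a j ≡ (rowOf x' ≤ᵇ rowOf x)
stRowBefore-source a a' zero    x x' a<a' x<x' rewrite ≰⇒≤ᵇ≡false (<⇒≱ a<a') | ≰⇒≤ᵇ≡false (<⇒≱ x<x') = refl
stRowBefore-source a a' (suc j) x x' a<a' x'<x rewrite ≤⇒≤ᵇ≡true (<⇒≤ a<a') | ≤⇒≤ᵇ≡true (<⇒≤ x'<x) = refl

stRowBefore-source⁻ : (a a' j : ℕ) (x x' : Cell) → a' < a → SourceOrder j x' x → stRowBefore a' a j ≡ (rowOf x' ≤ᵇ rowOf x)
stRowBefore-source⁻ a a' zero    x x' a'<a x'<x rewrite ≤⇒≤ᵇ≡true (<⇒≤ a'<a) | ≤⇒≤ᵇ≡true (<⇒≤ x'<x) = refl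
stRowBefore-source⁻ a a' (suc j) x x' a'<a x<x' rewrite ≰⇒≤ᵇ≡false (<⇒≱ a'<a) | ≰⇒≤ᵇ≡false (<⇒≱ x<x') = refl

stRowBefore-refl : (a j : ℕ) (x : Cell) → stRowBefore a a j ≡ (rowOf x ≤ᵇ rowOf x)
stRowBefore-refl a zero    x rewrite ≤⇒≤ᵇ≡true (≤-refl {a}) | ≤⇒≤ᵇ≡true (≤-refl {rowOf x}) = refl
stRowBefore-refl a (suc j) x rewrite ≤⇒≤ᵇ≡true (≤-refl {a}) | ≤⇒≤ᵇ≡true (≤-refl {rowOf x}) = refl

consecutive : ℕ → ℕ → List ℕ
consecutive k zero    = []
consecutive k (suc n) = k ∷ consecutive (suc k) n

map-suc-upTo : (n : ℕ) → map suc (upTo n) ≡ consecutive 1 n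
map-suc-upTo n = trans (List.map-applyUpTo id suc n) (applyUpTo-consecutive suc 1 n (λ _ → refl))
  where
  applyUpTo-consecutive : (g : ℕ → ℕ) (k n : ℕ) → (∀ i → g i ≡ k + i) → applyUpTo g n ≡ consecutive k n
  applyUpTo-consecutive g k zero    g≗ = refl
  applyUpTo-consecutive g k (suc n) g≗ =
    cong₂ _∷_ (trans (g≗ 0) (+-identityʳ k))
              (applyUpTo-consecutive (g ∘ suc) (suc k) n (λ i → trans (g≗ (suc i)) (+-suc k i)))

module _ (T : Filling) where

  stdLabel : Cell → ℕ
  stdLabel c = countB (λ c' → stdBefore c' c) (cells T)

  before-≼ : {a b : Cell} → a ≼ b → All (λ x → stdBefore x a ≡ true → stdBefore x b ≡ true) (cells T)
  before-≼ {a} {b} a≼b = All.tabulate λ {x} _ x≤a → stdBefore-complete x b (≼-trans (stdBefore-sound x a x≤a) a≼b)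

  stdLabel-mono : {a b : Cell} → a ≼ b → stdLabel a ≤ stdLabel b
  stdLabel-mono a≼b = countB-mono (before-≼ a≼b)

  stdLabel-strict : {a b : Cell} → a ≼ b → ¬ b ≼ a → b ∈ cells T → stdLabel a < stdLabel b
  stdLabel-strict {a} {b} a≼b b⋠a b∈ =
    countB-mono-< (before-≼ a≼b) b∈ (stdBefore-false b a b⋠a) (stdBefore-complete b b (≼-refl b))

  -- Equal entries in different columns are read right column first, so the left one gets the larger label.
  stdLabel-<ᵇ : (x e : Cell) → e ∈ cells T → colOf x < colOf e → (stdLabel x <ᵇ stdLabel e) ≡ (val x <ᵇ val e)
  stdLabel-<ᵇ x e e∈ col< with <-cmp (val x) (val e)
  ... | tri< v< _ _ rewrite <⇒<ᵇ≡true v< = <⇒<ᵇ≡true (stdLabel-strict (≼-val v<) (val<⇒⋡ v<) e∈)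
  ... | tri≈ _ v≡ _ rewrite ≮⇒<ᵇ≡false (<-irrefl v≡) = ≮⇒<ᵇ≡false (≤⇒≯ (stdLabel-mono (≼-col (sym v≡) col<)))
  ... | tri> _ _ v> rewrite ≮⇒<ᵇ≡false (<⇒≯ v>) = ≮⇒<ᵇ≡false (≤⇒≯ (stdLabel-mono (≼-val v>)))

  tagged : List (List Cell)
  tagged = tagRowsFrom 0 T

  sourceColumn : ℕ → List Cell
  sourceColumn k = columnAt k tagged

  sourceColumn-cells : (k : ℕ) → All (λ x → (colOf x ≡ k) × (x ∈ cells T)) (sourceColumn k)
  sourceColumn-cells k = All.map (λ (col≡ , x∈ , _) → col≡ , x∈) (columnAt-tagRowsFrom k 0 T)

  record KeepsColumns (r : List Cell) : Set where
    constructor mkKeepsColumns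
    field column-of : ∀ m {x} → lookupMaybe r m ≡ just x → (colOf x ≡ m) × (x ∈ cells T)
  open KeepsColumns

  KeepsColumns-∷ʳ : {r : List Cell} {e : Cell} → KeepsColumns r → colOf e ≡ length r → e ∈ cells T →
                    KeepsColumns (r ++ [ e ])
  KeepsColumns-∷ʳ {r} {e} keeps col≡ e∈ = mkKeepsColumns λ m look → new m look (lookupMaybe-++⁻ r e m look)
    where
    new : ∀ m {x} → lookupMaybe (r ++ [ e ]) m ≡ just x → (lookupMaybe r m ≡ just x) ⊎ ((m ≡ length r) × (x ≡ e)) →
          (colOf x ≡ m) × (x ∈ cells T)
    new m _ (inj₁ old)           = column-of keeps m old
    new m _ (inj₂ (refl , refl)) = col≡ , e∈

  KeepsColumns-placeTopDown : (k : ℕ) (e : Cell) (S : List (List Cell)) → colOf e ≡ k → e ∈ cells T →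
                              All KeepsColumns S → All KeepsColumns (placeTopDownBy val k e S)
  KeepsColumns-placeTopDown k e S col≡ e∈ keeps = All-placeTopDownBy val k e S keeps
    λ r acc keeps-r → KeepsColumns-∷ʳ keeps-r (trans col≡ (sym (accepts⇒length val k e r acc))) e∈

  KeepsColumns-placeAll : (k : ℕ) (S : List (List Cell)) (es : List Cell) →
                          All (λ e → (colOf e ≡ k) × (e ∈ cells T)) es →
                          All KeepsColumns S → All KeepsColumns (placeAllTopDownBy val k S es)
  KeepsColumns-placeAll k S []       []                  keeps = keeps
  KeepsColumns-placeAll k S (e ∷ es) ((col≡ , e∈) ∷ h) keeps =
    KeepsColumns-placeAll k (placeTopDownBy val k e S) es h (KeepsColumns-placeTopDown k e S col≡ e∈ keeps)

  initialRows-keepColumns : All KeepsColumns (map [_] (sourceColumn 0))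
  initialRows-keepColumns = Allₚ.map⁺ (All.map single (sourceColumn-cells 0))
    where
    single : ∀ {x} → (colOf x ≡ 0) × (x ∈ cells T) → KeepsColumns [ x ]
    single col∈ = mkKeepsColumns λ { zero refl → col∈ }

  PreservesLeftComparisons : (Cell → ℕ) → Set
  PreservesLeftComparisons f = ∀ x e → e ∈ cells T → colOf x < colOf e → (f x <ᵇ f e) ≡ (val x <ᵇ val e)

  module _ (f : Cell → ℕ) (preserves : PreservesLeftComparisons f) where

    lastBelow-relabel : (k : ℕ) (e : Cell) → colOf e ≡ suc k → e ∈ cells T → (S : List (List Cell)) → All KeepsColumns S →
                        All (λ r → length r ≡ suc k → lastBelow val r e ≡ lastBelow f r e) S
    lastBelow-relabel k e col≡ e∈ S keeps = All.map agree keeps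
      where
      agree : {r : List Cell} → KeepsColumns r → length r ≡ suc k → lastBelow val r e ≡ lastBelow f r e
      agree {r} keeps-r len≡ rewrite last≡lookupMaybe r k len≡ with lookupMaybe r k in look
      ... | nothing = refl
      ... | just x  = sym (preserves x e e∈ (subst₂ _<_ (sym (proj₁ (column-of keeps-r k look))) (sym col≡) ≤-refl))

    placeAll-relabel : (k : ℕ) (S : List (List Cell)) (es : List Cell) →
                       All (λ e → (colOf e ≡ suc k) × (e ∈ cells T)) es → All KeepsColumns S →
                       map (map f) (placeAllTopDownBy val (suc k) S es)
                         ≡ foldl (λ rs e → placeTopDown (suc k) e rs) (map (map f) S) (map f es)
    placeAll-relabel k S []       []                  keeps = refl
    placeAll-relabel k S (e ∷ es) ((col≡ , e∈) ∷ h) keeps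
      rewrite placeAll-relabel k (placeTopDownBy val (suc k) e S) es h
                (KeepsColumns-placeTopDown (suc k) e S col≡ e∈ keeps)
            | placeTopDown-map f val (suc k) e S (lastBelow-relabel k e col≡ e∈ S keeps) = refl

  -- Rows are kept top to bottom during insertion, as placeTopDown expects.
  placeColumnsTopDown : List (List Cell) → List ℕ → List (List Cell)
  placeColumnsTopDown = foldl (λ S k → placeAllTopDownBy val k S (sourceColumn k))

  initialRows : List (List Cell)
  initialRows = reverse (map [_] (sourceColumn 0))

  finalRows : List (List Cell)
  finalRows = placeColumnsTopDown initialRows (consecutive 1 (numCols T ∸ 1))

  ρ-tagged : List (List Cell)
  ρ-tagged = reverse finalRows

  module _ (f : Cell → ℕ) (preserves : PreservesLeftComparisons f)
           (sorted : ∀ k → AllPairs _≤_ (map f (sourceColumn k))) where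

    placeColumn-relabel : (k : ℕ) (R : List (List Cell)) → All KeepsColumns R →
      placeColumn (map (map f) tagged) (map (map f) R) (suc k)
        ≡ map (map f) (reverse (placeAllTopDownBy val (suc k) (reverse R) (sourceColumn (suc k))))
    placeColumn-relabel k R keeps = begin
      foldl (λ rs e → place (suc k) e rs) (map (map f) R) (sortAsc (column (suc k) (map (map f) tagged)))
        ≡⟨ cong (foldl (λ rs e → place (suc k) e rs) (map (map f) R))
                (trans (cong sortAsc (column-map f (suc k) tagged)) (sortAsc-id _ (sorted (suc k)))) ⟩
      foldl (λ rs e → place (suc k) e rs) (map (map f) R) (map f (sourceColumn (suc k)))
        ≡⟨ foldl-place (suc k) (map (map f) R) (map f (sourceColumn (suc k))) ⟩
      reverse (foldl (λ rs e → placeTopDown (suc k) e rs) (reverse (map (map f) R)) (map f (sourceColumn (suc k))))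
        ≡⟨ cong (λ S → reverse (foldl (λ rs e → placeTopDown (suc k) e rs) S (map f (sourceColumn (suc k)))))
                (List.reverse-map (map f) R) ⟨
      reverse (foldl (λ rs e → placeTopDown (suc k) e rs) (map (map f) (reverse R)) (map f (sourceColumn (suc k))))
        ≡⟨ cong reverse (placeAll-relabel f preserves k (reverse R) (sourceColumn (suc k))
                           (sourceColumn-cells (suc k)) (All-reverse keeps)) ⟨
      reverse (map (map f) (placeAllTopDownBy val (suc k) (reverse R) (sourceColumn (suc k))))
        ≡⟨ List.reverse-map (map f) (placeAllTopDownBy val (suc k) (reverse R) (sourceColumn (suc k))) ⟨
      map (map f) (reverse (placeAllTopDownBy val (suc k) (reverse R) (sourceColumn (suc k)))) ∎
      where open ≡-Reasoning

    foldl-placeColumn-relabel : (ks : List ℕ) (R : List (List Cell)) → All KeepsColumns R →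
      foldl (placeColumn (map (map f) tagged)) (map (map f) R) (map suc ks)
        ≡ map (map f) (reverse (placeColumnsTopDown (reverse R) (map suc ks)))
    foldl-placeColumn-relabel []       R keeps = cong (map (map f)) (sym (List.reverse-involutive R))
    foldl-placeColumn-relabel (k ∷ ks) R keeps rewrite placeColumn-relabel k R keeps =
      trans (foldl-placeColumn-relabel ks R′ (All-reverse keeps′))
            (cong (λ S → map (map f) (reverse (placeColumnsTopDown S (map suc ks)))) (List.reverse-involutive _))
      where
      S′ R′ : List (List Cell)
      S′ = placeAllTopDownBy val (suc k) (reverse R) (sourceColumn (suc k))
      R′ = reverse S′
      keeps′ : All KeepsColumns S′
      keeps′ = KeepsColumns-placeAll (suc k) (reverse R) (sourceColumn (suc k)) (sourceColumn-cells (suc k))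
                                     (All-reverse keeps)

    ρ-relabel : ρ (map (map f) tagged) ≡ map (map f) ρ-tagged
    ρ-relabel = begin
      ρ (map (map f) tagged)
        ≡⟨ cong (λ n → foldl (placeColumn (map (map f) tagged)) (firstColumn (map (map f) tagged)) (map suc (upTo (n ∸ 1))))
                (numCols-tagRowsFrom f 0 T) ⟩
      foldl (placeColumn (map (map f) tagged)) (firstColumn (map (map f) tagged)) (map suc (upTo n))
        ≡⟨ cong (λ R → foldl (placeColumn (map (map f) tagged)) R (map suc (upTo n))) firstColumn-relabel ⟩
      foldl (placeColumn (map (map f) tagged)) (map (map f) (map [_] (sourceColumn 0))) (map suc (upTo n))
        ≡⟨ foldl-placeColumn-relabel (upTo n) (map [_] (sourceColumn 0)) initialRows-keepColumns ⟩
      map (map f) (reverse (placeColumnsTopDown initialRows (map suc (upTo n))))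
        ≡⟨ cong (λ ks → map (map f) (reverse (placeColumnsTopDown initialRows ks))) (map-suc-upTo n) ⟩
      map (map f) ρ-tagged ∎
      where
      open ≡-Reasoning
      n : ℕ
      n = numCols T ∸ 1
      firstColumn-relabel : firstColumn (map (map f) tagged) ≡ map (map f) (map [_] (sourceColumn 0))
      firstColumn-relabel = begin
        map [_] (sortAsc (column 0 (map (map f) tagged)))
          ≡⟨ cong (map [_] ∘ sortAsc) (column-map f 0 tagged) ⟩
        map [_] (sortAsc (map f (sourceColumn 0)))
          ≡⟨ cong (map [_]) (sortAsc-id _ (sorted 0)) ⟩
        map [_] (map f (sourceColumn 0))
          ≡⟨ trans (sym (List.map-∘ (sourceColumn 0))) (List.map-∘ (sourceColumn 0)) ⟩
        map (map f) (map [_] (sourceColumn 0)) ∎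

  record Placed (k : ℕ) (S : List (List Cell)) : Set where
    field
      keepsColumns : All KeepsColumns S
      short        : All (λ r → length r ≤ suc k) S
      lastColumn   : columnAt k S ↭ sourceColumn k
      entries      : concat S ↭ columnsUpTo (suc k) tagged
      ties         : AllPairs (flip TiesOrdered) S

  -- Midway through inserting column suc k.
  record Placing (k : ℕ) (placed pending : List Cell) (S : List (List Cell)) : Set where
    field
      keepsColumns : All KeepsColumns S
      short        : All (λ r → length r ≤ suc (suc k)) S
      leftColumn   : columnAt k S ↭ sourceColumn k
      newColumn    : columnAt (suc k) S ↭ placed
      entries      : concat S ↭ columnsUpTo (suc k) tagged ++ placed
      ties         : AllPairs (flip TiesOrdered) S
      refuses      : AllPairs (Refuses (suc k)) S
      earlier      : All (λ x → All (λ e → rowOf x < rowOf e) pending) (columnAt (suc k) S)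

  start-placing : (k : ℕ) (S : List (List Cell)) → Placed k S → Placing k [] (sourceColumn (suc k)) S
  start-placing k S inv = record
    { keepsColumns = keepsColumns
    ; short        = All.map m≤n⇒m≤1+n short
    ; leftColumn   = lastColumn
    ; newColumn    = ↭-reflexive empty
    ; entries      = ↭-trans entries (↭-reflexive (sym (List.++-identityʳ _)))
    ; ties         = ties
    ; refuses      = refuses-short S short
    ; earlier      = subst (All _) (sym empty) []
    }
    where
    open Placed inv
    empty : columnAt (suc k) S ≡ []
    empty = columnAt-short (suc k) S short
    refuses-short : (S : List (List Cell)) → All (λ r → length r ≤ suc k) S → AllPairs (Refuses (suc k)) S
    refuses-short []       []         = []
    refuses-short (r ∷ rs) (_ ∷ h) =
      All.map (λ {r'} r'≤ _ {_} look → ⊥-elim (nothing≢just (trans (sym (lookupMaybe-≥ r' (suc k) r'≤)) look))) h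
      ∷ refuses-short rs h
      where
      nothing≢just : ∀ {x : Cell} → nothing ≡ just x → ⊥
      nothing≢just ()

  finish-placing : (k : ℕ) (S : List (List Cell)) → Placing k (sourceColumn (suc k)) [] S → Placed (suc k) S
  finish-placing k S inv = record
    { keepsColumns = keepsColumns
    ; short        = short
    ; lastColumn   = newColumn
    ; entries      = entries
    ; ties         = ties
    }
    where open Placing inv

  initialRows-placed : Placed 0 initialRows
  initialRows-placed = record
    { keepsColumns = All-reverse initialRows-keepColumns
    ; short        = All-reverse (Allₚ.map⁺ (All.tabulate {xs = sourceColumn 0} λ _ → ≤-refl))
    ; lastColumn   = ↭-trans (columnAt-reverse 0 (map [_] (sourceColumn 0))) (↭-reflexive (columnAt-singletons (sourceColumn 0)))
    ; entries      = ↭-trans (concat-reverse (map [_] (sourceColumn 0)))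
                             (↭-reflexive (concat-singletons (sourceColumn 0)))
    ; ties         = AllPairs-reverse (map [_] (sourceColumn 0)) (singletons-ordered (columnAt-tagRowsFrom-rows 0 0 T))
    }
    where
    columnAt-singletons : (l : List Cell) → columnAt 0 (map [_] l) ≡ l
    columnAt-singletons []      = refl
    columnAt-singletons (x ∷ l) = cong (x ∷_) (columnAt-singletons l)
    concat-singletons : (l : List Cell) → concat (map [_] l) ≡ l
    concat-singletons []      = refl
    concat-singletons (x ∷ l) = cong (x ∷_) (concat-singletons l)
    singletons-ordered : {l : List Cell} → AllPairs (λ a b → rowOf a < rowOf b) l → AllPairs TiesOrdered (map [_] l)
    singletons-ordered []              = []
    singletons-ordered (x< ∷ h) = Allₚ.map⁺ (All.map (λ x<y → λ { zero refl refl _ → x<y }) x<) ∷ singletons-ordered h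

  stBefore-cellsFrom′ : (m : ℕ) (X : List (List Cell)) → All KeepsColumns X → AllPairs TiesOrdered X →
                        {t t' : ℕ × ℕ × Cell} → t ∈ cellsFrom′ m X → t' ∈ cellsFrom′ m X →
                        stBefore (valAt t') (valAt t) ≡ stdBefore (entry t') (entry t)
  stBefore-cellsFrom′ m (r ∷ rs) (keeps-r ∷ keeps) (ties-r ∷ ties) {a , b , x} {a' , b' , x'} t∈ t'∈
    with ∈-++⁻ (cellsRow′ m 0 r) t∈ | ∈-++⁻ (cellsRow′ m 0 r) t'∈
  ... | inj₂ t∈rs | inj₂ t'∈rs = stBefore-cellsFrom′ (suc m) rs keeps ties t∈rs t'∈rs
  ... | inj₁ t∈r  | inj₁ t'∈r with ∈-cellsRow′ m 0 r t∈r | ∈-cellsRow′ m 0 r t'∈r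
  ...   | refl , j , refl , look | refl , j' , refl , look' =
    stBefore≡stdBefore m j m j' x x' (proj₁ (column-of keeps-r j look)) (proj₁ (column-of keeps-r j' look'))
      λ { _ refl → subst (λ z → stRowBefore m m j ≡ (rowOf z ≤ᵇ rowOf x))
                         (Maybe.just-injective (trans (sym look) look')) (stRowBefore-refl m j x) }
  stBefore-cellsFrom′ m (r ∷ rs) (keeps-r ∷ keeps) (ties-r ∷ ties) {a , b , x} {a' , b' , x'} t∈ t'∈
    | inj₁ t∈r | inj₂ t'∈rs with ∈-cellsRow′ m 0 r t∈r | ∈-cellsFrom′ (suc m) rs t'∈rs
  ...   | refl , j , refl , look | m<a' , r' , r'∈ , look' =
    stBefore≡stdBefore m j a' b' x x' (proj₁ (column-of keeps-r j look)) (proj₁ (column-of (All.lookup keeps r'∈) b' look'))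
      λ { v≡ refl → stRowBefore-source m a' j x x' m<a' (All.lookup ties-r r'∈ j look look' (sym v≡)) }
  stBefore-cellsFrom′ m (r ∷ rs) (keeps-r ∷ keeps) (ties-r ∷ ties) {a , b , x} {a' , b' , x'} t∈ t'∈
    | inj₂ t∈rs | inj₁ t'∈r with ∈-cellsFrom′ (suc m) rs t∈rs | ∈-cellsRow′ m 0 r t'∈r
  ...   | m<a , r' , r'∈ , look | refl , j' , refl , look' =
    stBefore≡stdBefore a b m j' x x' (proj₁ (column-of (All.lookup keeps r'∈) b look)) (proj₁ (column-of keeps-r j' look'))
      λ { v≡ refl → stRowBefore-source⁻ a m j' x x' m<a (All.lookup ties-r r'∈ j' look' look v≡) }

  module _ (H : RowStrictSSYT T) where
    open RowStrictSSYT H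

    map-val-sourceColumn : (k : ℕ) → map val (sourceColumn k) ≡ column k T
    map-val-sourceColumn k = trans (sym (column-map val k tagged)) (cong (column k) (map-val-tagRowsFrom 0 T))

    sourceColumn-sorted : (k : ℕ) → AllPairs (λ a b → val a ≤ val b) (sourceColumn k)
    sourceColumn-sorted k =
      AllPairsₚ.map⁻ (subst (AllPairs _≤_) (sym (map-val-sourceColumn k)) (column-sorted k T columnsWeak))

    count≤-sourceColumn-suc : (v k : ℕ) →
      countB (λ c → val c ≤ᵇ v) (sourceColumn (suc k)) ≤ countB (λ d → val d <ᵇ v) (sourceColumn k)
    count≤-sourceColumn-suc v k = subst₂ _≤_ (via-val (_≤ᵇ v) (suc k)) (via-val (_<ᵇ v) k)
                                         (count≤-column-suc≤count<-column v k T rowsStrict)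
      where
      via-val : (p : ℕ → Bool) (j : ℕ) → countB p (column j T) ≡ countB (p ∘ val) (sourceColumn j)
      via-val p j = trans (cong (countB p) (sym (map-val-sourceColumn j))) (countB-map p val (sourceColumn j))

    -- Hall's condition: the entries ≤ e of column suc k, e included, are at most the entries < e of
    -- column k; only the already placed ones have a right neighbour, so some row accepts e.
    placing-accepts : (k : ℕ) (placed : List Cell) (e : Cell) (pending : List Cell) (S : List (List Cell)) →
                      placed ++ e ∷ pending ≡ sourceColumn (suc k) → Placing k placed (e ∷ pending) S →
                      Any (λ r → accepts val (suc k) e r ≡ true) S
    placing-accepts k placed e pending S split inv = countB-Any S (+-cancelˡ-≤ (length placed) 1 _ (begin
        length placed + 1
          ≤⟨ +-monoʳ-≤ (length placed) (s≤s z≤n) ⟩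
        length placed + suc (countB (λ c → val c ≤ᵇ val e) pending)
          ≡⟨ count≤e ⟨
        countB (λ c → val c ≤ᵇ val e) column′
          ≡⟨ cong (countB (λ c → val c ≤ᵇ val e)) split ⟩
        countB (λ c → val c ≤ᵇ val e) (sourceColumn (suc k))
          ≤⟨ count≤-sourceColumn-suc (val e) k ⟩
        countB (λ d → val d <ᵇ val e) (sourceColumn k)
          ≡⟨ countB-↭ (λ d → val d <ᵇ val e) leftColumn ⟨
        countB (λ d → val d <ᵇ val e) (columnAt k S)
          ≤⟨ count<-left≤filled+accepting S ⟩
        length (columnAt (suc k) S) + countB (accepts val (suc k) e) S
          ≡⟨ cong (_+ _) (↭.↭-length newColumn) ⟩
        length placed + countB (accepts val (suc k) e) S ∎))
      where
      open Placing inv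
      open Insertion k e using (count<-left≤filled+accepting)
      open ≤-Reasoning

      column′ : List Cell
      column′ = placed ++ e ∷ pending

      placed≤e : All (λ c → (val c ≤ᵇ val e) ≡ true) placed
      placed≤e = All.map ≤⇒≤ᵇ≡true (AllPairs-before placed (subst (AllPairs _) (sym split) (sourceColumn-sorted (suc k))))

      count≤e : countB (λ c → val c ≤ᵇ val e) column′ ≡ length placed + suc (countB (λ c → val c ≤ᵇ val e) pending)
      count≤e rewrite countB-++ (λ c → val c ≤ᵇ val e) placed (e ∷ pending) | countB-all placed placed≤e
                    | ≤⇒≤ᵇ≡true (≤-refl {val e}) = refl


    placing-step : (k : ℕ) (placed : List Cell) (e : Cell) (pending : List Cell) (S : List (List Cell)) →
                   placed ++ e ∷ pending ≡ sourceColumn (suc k) → Placing k placed (e ∷ pending) S →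
                   Placing k (placed ++ [ e ]) pending (placeTopDownBy val (suc k) e S)
    placing-step k placed e pending S split inv = record
      { keepsColumns = KeepsColumns-placeTopDown (suc k) e S (proj₁ e-source) (proj₂ e-source) keepsColumns
      ; short        = All-placeTopDownBy val (suc k) e S short λ r acc _ →
                         ≤-reflexive (trans (length-∷ʳ r e) (cong suc (accepts⇒length val (suc k) e r acc)))
      ; leftColumn   = ↭-trans (↭-reflexive (columnAt-left-placeTopDown S)) leftColumn
      ; newColumn    = ↭-trans (columnAt-placeTopDown S accepting) (↭-trans (↭-prep e newColumn) (↭.∷↭∷ʳ e placed))
      ; entries      = ↭-trans (concat-placeTopDown S accepting)
                         (↭-trans (↭-prep e entries)
                         (↭-trans (↭.∷↭∷ʳ e (columnsUpTo (suc k) tagged ++ placed))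
                                  (↭-reflexive (List.++-assoc (columnsUpTo (suc k) tagged) placed [ e ]))))
      ; ties         = ties-placeTopDown S ties refuses (All.map All.head earlier)
      ; refuses      = refuses-placeTopDown S refuses
      ; earlier      = All-columnAt-placeTopDown S (All.map All.tail earlier) e-below-pending
      }
      where
      open Placing inv
      open Insertion k e

      e-source : (colOf e ≡ suc k) × (e ∈ cells T)
      e-source = All.head (Allₚ.++⁻ʳ placed (subst (All _) (sym split) (sourceColumn-cells (suc k))))

      e-below-pending : All (λ y → rowOf e < rowOf y) pending
      e-below-pending = AllPairs.head (AllPairs-++⁻ʳ placed (subst (AllPairs _) (sym split) (columnAt-tagRowsFrom-rows (suc k) 0 T)))

      accepting : Any (λ r → accepts val (suc k) e r ≡ true) S
      accepting = placing-accepts k placed e pending S split inv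

    placing-all : (k : ℕ) (placed pending : List Cell) (S : List (List Cell)) →
                  placed ++ pending ≡ sourceColumn (suc k) → Placing k placed pending S →
                  Placing k (sourceColumn (suc k)) [] (placeAllTopDownBy val (suc k) S pending)
    placing-all k placed []            S split inv =
      subst (λ c → Placing k c [] S) (trans (sym (List.++-identityʳ placed)) split) inv
    placing-all k placed (e ∷ pending) S split inv =
      placing-all k (placed ++ [ e ]) pending (placeTopDownBy val (suc k) e S)
                  (trans (List.++-assoc placed [ e ] pending) split) (placing-step k placed e pending S split inv)

    placed-consecutive : (n k : ℕ) (S : List (List Cell)) → Placed k S →
                         Placed (k + n) (placeColumnsTopDown S (consecutive (suc k) n))
    placed-consecutive zero    k S inv = subst (λ j → Placed j S) (sym (+-identityʳ k)) inv
    placed-consecutive (suc n) k S inv =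
      subst (λ j → Placed j (placeColumnsTopDown S′ (consecutive (suc (suc k)) n))) (sym (+-suc k n))
            (placed-consecutive n (suc k) S′
              (finish-placing k S′ (placing-all k [] (sourceColumn (suc k)) S refl (start-placing k S inv))))
      where
      S′ : List (List Cell)
      S′ = placeAllTopDownBy val (suc k) S (sourceColumn (suc k))

    finalRows-placed : Placed (numCols T ∸ 1) finalRows
    finalRows-placed = placed-consecutive (numCols T ∸ 1) 0 initialRows initialRows-placed

    ρ-tagged-entries : concat ρ-tagged ↭ cells T
    ρ-tagged-entries = begin
      concat (reverse finalRows)                 ↭⟨ concat-reverse finalRows ⟩
      concat finalRows                           ↭⟨ Placed.entries finalRows-placed ⟩
      columnsUpTo (suc (numCols T ∸ 1)) tagged   ↭⟨ columnsUpTo-concat _ tagged (tagged-short 0 T (rows-bounded T columnsWeak)) ⟩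
      concat tagged                              ≡⟨ concat-tagRowsFrom 0 T ⟩
      cells T                                    ∎
      where
      open PermutationReasoning
      tagged-short : (i : ℕ) (X : Filling) → All (λ r → length r ≤ numCols T) X →
                     All (λ r → length r ≤ suc (numCols T ∸ 1)) (tagRowsFrom i X)
      tagged-short i []       []         = []
      tagged-short i (r ∷ rs) (r≤ ∷ h) =
        subst (_≤ _) (sym (length-cellsRow i 0 r)) (≤-trans r≤ (m≤n+m∸n (numCols T) 1)) ∷ tagged-short (suc i) rs h

    st-ρ-tagged : st (map (map val) ρ-tagged) ≡ map (map stdLabel) ρ-tagged
    st-ρ-tagged = relabelFrom-map-val _ stdLabel 0 ρ-tagged λ a b x t∈ → begin
      countB (λ c' → stBefore c' (a , b , val x)) (cells (map (map val) ρ-tagged))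
        ≡⟨ cong (countB _) (cellsFrom-map-val 0 ρ-tagged) ⟩
      countB (λ c' → stBefore c' (a , b , val x)) (map valAt (cellsFrom′ 0 ρ-tagged))
        ≡⟨ countB-map _ valAt (cellsFrom′ 0 ρ-tagged) ⟩
      countB (λ t' → stBefore (valAt t') (a , b , val x)) (cellsFrom′ 0 ρ-tagged)
        ≡⟨ countB-cong (All.tabulate λ t'∈ → stBefore-cellsFrom′ 0 ρ-tagged keeps ties t∈ t'∈) ⟩
      countB (λ t' → stdBefore (entry t') x) (cellsFrom′ 0 ρ-tagged)
        ≡⟨ countB-map (λ y → stdBefore y x) entry (cellsFrom′ 0 ρ-tagged) ⟨
      countB (λ y → stdBefore y x) (map entry (cellsFrom′ 0 ρ-tagged))
        ≡⟨ cong (countB _) (map-entry-cellsFrom′ 0 ρ-tagged) ⟩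
      countB (λ y → stdBefore y x) (concat ρ-tagged)
        ≡⟨ countB-↭ _ ρ-tagged-entries ⟩
      stdLabel x ∎
      where
      open ≡-Reasoning
      keeps : All KeepsColumns ρ-tagged
      keeps = All-reverse (Placed.keepsColumns finalRows-placed)
      ties : AllPairs TiesOrdered ρ-tagged
      ties = AllPairs-reverse finalRows (Placed.ties finalRows-placed)

    stdLabel-sorted : (k : ℕ) → AllPairs _≤_ (map stdLabel (sourceColumn k))
    stdLabel-sorted k = AllPairsₚ.map⁺ (sorted (sourceColumn k) (All.map proj₁ (sourceColumn-cells k))
                          (AllPairs.zip (sourceColumn-sorted k , columnAt-tagRowsFrom-rows k 0 T)))
      where
      up : ∀ {x y} → colOf x ≡ k → colOf y ≡ k → (val x ≤ val y) × (rowOf x < rowOf y) → stdLabel x ≤ stdLabel y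
      up cx cy (v≤ , r<) with m≤n⇒m<n∨m≡n v≤
      ... | inj₁ v< = stdLabel-mono (≼-val v<)
      ... | inj₂ v≡ = stdLabel-mono (≼-row v≡ (trans cx (sym cy)) (<⇒≤ r<))
      sorted : (xs : List Cell) → All (λ x → colOf x ≡ k) xs →
               AllPairs (λ a b → (val a ≤ val b) × (rowOf a < rowOf b)) xs → AllPairs (λ a b → stdLabel a ≤ stdLabel b) xs
      sorted []       []         []       = []
      sorted (x ∷ xs) (cx ∷ cs) (h ∷ hs) = All.zipWith (λ (cy , p) → up cx cy p) (cs , h) ∷ sorted xs cs hs

    ρ-val : ρ T ≡ map (map val) ρ-tagged
    ρ-val = trans (cong ρ (sym (map-val-tagRowsFrom 0 T)))
                  (ρ-relabel val (λ _ _ _ _ → refl) (λ k → AllPairsₚ.map⁺ (sourceColumn-sorted k)))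

    ρ-std : ρ (std T) ≡ map (map stdLabel) ρ-tagged
    ρ-std = trans (cong ρ (relabelFrom-tagRowsFrom _ stdLabel (λ _ _ _ → refl) 0 T))
                  (ρ-relabel stdLabel stdLabel-<ᵇ stdLabel-sorted)

theorem2 : (T : Filling) → RowStrictSSYT T → st (ρ T) ≡ ρ (std T)
theorem2 T H = begin
  st (ρ T)                             ≡⟨ cong st (ρ-val T H) ⟩
  st (map (map val) (ρ-tagged T))      ≡⟨ st-ρ-tagged T H ⟩
  map (map (stdLabel T)) (ρ-tagged T)  ≡⟨ ρ-std T H ⟨
  ρ (std T)                            ∎
  where open ≡-Reasoning
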